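{- Let $\ell>2$, let $\lambda$ be an $(\ell,0)$-JM partition and let $i$ be a residue. Then the ladder $i$-signature of $\lambda$ contains no $-$ immediately followed by $+$; equivalently, it coincides with the reduced ladder $i$-signature of $\lambda$.
   Context: Partitions are identified with Young diagrams; $(x,y)$ is the box in row $x$, column $y$, with residue $y-x\bmod\ell$. The ladder $i$-signature of $\lambda$: mark each removable box of $\lambda$ of residue $i$ (box whose removal leaves a partition) by $-$ and each addable position of residue $i$ (position whose addition gives a partition) by $+$, and read these signs ordering positions $(x,y)$ by ladder number $x+(\ell-1)(y-1)$ increasing and, within a ladder, by row index increasing (top to bottom). The reduced signature is obtained by successively cancelling adjacent pairs $-+$. The hook length $h^\lambda_{(a,c)}$ of a box is the number of boxes of $\lambda$ to its right in its row or below it in its column, including itself. $\lambda$ is an $(\ell,0)$-JM partition if there do NOT exist boxes $(a,b),(a,y),(x,b)$ in $\lambda$ with $\ell\mid h^\lambda_{(a,b)}$, $\ell\nmid h^\lambda_{(a,y)}$, $\ell\nmid h^\lambda_{(x,b)}$. -}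

module Defs where

open import Data.Nat using (ℕ; zero; suc; _+_; _*_; _∸_; _≤_; _<_; _≥_; _≤ᵇ_; _<ᵇ_; _≡ᵇ_; NonZero)
open import Data.Nat.DivMod using (_%_)
open import Data.Nat.Divisibility using (_∣_)
open import Data.Bool using (Bool; true; false; _∧_; _∨_; not; if_then_else_; T)
open import Data.List using (List; []; _∷_; length; filter; map; concatMap; upTo; _++_)
open import Data.List.Relation.Unary.All using (All)
open import Data.List.Relation.Unary.Linked using (Linked)
open import Data.Product using (_×_; _,_; ∃; ∃-syntax; proj₁; proj₂)
open import Relation.Nullary using (¬_)
open import Relation.Binary.PropositionalEquality using (_≡_)

IsPartition : List ℕ → Set
IsPartition λ′ = All (0 <_) λ′ × Linked _≥_ λ′

-- length of row x (rows indexed from 1; row 0 and rows beyond have length 0)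
row : List ℕ → ℕ → ℕ
row _        zero          = 0
row []       (suc _)       = 0
row (a ∷ _)  (suc zero)    = a
row (_ ∷ as) (suc (suc x)) = row as (suc x)

col : List ℕ → ℕ → ℕ
col λ′ y = length (filter (λ a → y Data.Nat.≤? a) λ′)

inλᵇ : List ℕ → ℕ → ℕ → Bool
inλᵇ λ′ x y = (1 ≤ᵇ x) ∧ ((1 ≤ᵇ y) ∧ (y ≤ᵇ row λ′ x))

InBox : List ℕ → ℕ → ℕ → Set
InBox λ′ x y = T (inλᵇ λ′ x y)

hook : List ℕ → ℕ → ℕ → ℕ
hook λ′ x y = (row λ′ x ∸ y) + (col λ′ y ∸ x) + 1

IsJM : ℕ → List ℕ → Set
IsJM ℓ λ′ = ¬ (∃[ a ] ∃[ b ] ∃[ x ] ∃[ y ]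
  (InBox λ′ a b × InBox λ′ a y × InBox λ′ x b ×
   (ℓ ∣ hook λ′ a b) × ¬ (ℓ ∣ hook λ′ a y) × ¬ (ℓ ∣ hook λ′ x b)))

-- residue of (x , y): (y - x) mod ℓ  (computed as (y + ℓ x - x) mod ℓ)
residue : (ℓ : ℕ) .{{_ : NonZero ℓ}} → ℕ → ℕ → ℕ
residue ℓ x y = (y + ℓ * x ∸ x) % ℓ

removableᵇ : List ℕ → ℕ → ℕ → Bool
removableᵇ λ′ x y = inλᵇ λ′ x y ∧ (not (inλᵇ λ′ (suc x) y) ∧ not (inλᵇ λ′ x (suc y)))

addableᵇ : List ℕ → ℕ → ℕ → Bool
addableᵇ λ′ x y =
  not (inλᵇ λ′ x y) ∧ ((1 ≤ᵇ x) ∧ ((1 ≤ᵇ y) ∧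
  (((x ≡ᵇ 1) ∨ inλᵇ λ′ (x ∸ 1) y) ∧ ((y ≡ᵇ 1) ∨ inλᵇ λ′ x (y ∸ 1)))))

data Sign : Set where
  plus minus : Sign

ladder : ℕ → ℕ → ℕ → ℕ
ladder ℓ x y = x + (ℓ ∸ 1) * (y ∸ 1)

-- candidate positions: rows 1..len+1, columns 1..λ₁+1 (contain all
-- removable boxes and addable positions)
candidates : List ℕ → List (ℕ × ℕ)
candidates λ′ =
  concatMap (λ x → map (λ y → (suc x , suc y)) (upTo (suc (row λ′ 1))))
            (upTo (suc (length λ′)))

signed : (ℓ : ℕ) .{{_ : NonZero ℓ}} → List ℕ → ℕ → List (ℕ × ℕ × Sign)
signed ℓ λ′ i = concatMap f (candidates λ′)
  where
  f : ℕ × ℕ → List (ℕ × ℕ × Sign)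
  f (x , y) =
    if residue ℓ x y Data.Nat.≡ᵇ i
    then (if removableᵇ λ′ x y then (ladder ℓ x y , x , minus) ∷ []
          else if addableᵇ λ′ x y then (ladder ℓ x y , x , plus) ∷ []
          else [])
    else []

beforeᵇ : ℕ × ℕ × Sign → ℕ × ℕ × Sign → Bool
beforeᵇ (L₁ , x₁ , _) (L₂ , x₂ , _) = (L₁ <ᵇ L₂) ∨ ((L₁ ≡ᵇ L₂) ∧ (x₁ ≤ᵇ x₂))

insert : ℕ × ℕ × Sign → List (ℕ × ℕ × Sign) → List (ℕ × ℕ × Sign)
insert e [] = e ∷ []
insert e (d ∷ ds) = if beforeᵇ e d then e ∷ d ∷ ds else d ∷ insert e ds

sort : List (ℕ × ℕ × Sign) → List (ℕ × ℕ × Sign)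
sort [] = []
sort (e ∷ es) = insert e (sort es)

ladderSignature : (ℓ : ℕ) .{{_ : NonZero ℓ}} → List ℕ → ℕ → List Sign
ladderSignature ℓ λ′ i = map (λ e → proj₂ (proj₂ e)) (sort (signed ℓ λ′ i))

HasMinusPlus : List Sign → Set
HasMinusPlus s = ∃[ u ] ∃[ v ] (s ≡ u ++ (minus ∷ plus ∷ v))

module Submission where

-- The heart of the proof is a geometric comparison (plus-precedes-minus):
-- if (x , y) is a removable box and (x′ , y′) an addable position of the same
-- residue, then the addable position comes strictly first in the ladder
-- order.  A removable box ends its row and its column, so its hook is 1 and
-- not divisible by ℓ.  If (x′ , y′) lies below it, the congruence of residues
-- makes the hook of (x , y′) a multiple of ℓ; the JM condition then forces
-- every hook further down column y′ to be a multiple of ℓ, and a strictly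
-- decreasing chain of positive multiples of ℓ gives a long arm, hence a
-- smaller ladder.  The case "above" is the transpose (row instead of column),
-- and the case "same row" contradicts the residues.

open import Defs
open import Data.Bool using (true; false; T; not; _∨_; if_then_else_)
open import Data.Bool.Properties using (T-∧; T-∨; T-≡; T-not-≡)
open import Data.Empty using (⊥; ⊥-elim)
open import Data.List using (List; []; _∷_; map; length)
open import Data.List.Properties using (∷-injectiveˡ; ∷-injectiveʳ; filter-accept; filter-reject)
open import Data.List.Relation.Unary.All using (All; []; _∷_; universal)
open import Data.List.Relation.Unary.All.Properties using (concat⁺; map⁺)
open import Data.List.Relation.Unary.Linked using (Linked; []; [-]; _∷_; tail)
open import Data.Nat using (ℕ; zero; suc; _+_; _*_; _∸_; _≤_; _<_; _≥_; z≤n; s≤s; NonZero; >-nonZero; _≤?_; _<ᵇ_; _≤ᵇ_; _≡ᵇ_)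
open import Data.Nat.Properties
open import Data.Nat.DivMod using (_%_; _/_; m≡m%n+[m/n]*n)
open import Data.Nat.Divisibility using (_∣_; _∣?_; divides; ∣m+n∣m⇒∣n; ∣⇒≤; ∣1⇒≡1; n∣m*n)
open import Data.Nat.Tactic.RingSolver using (solve-∀)
open import Data.Product using (_×_; _,_; proj₁; proj₂)
open import Data.Sum using (_⊎_; inj₁; inj₂; [_,_]′)
open import Function.Bundles using (module Equivalence)
open import Relation.Binary.Definitions using (tri<; tri≈; tri>)
open import Relation.Binary.PropositionalEquality
open import Relation.Nullary using (¬_; yes; no)
open import Relation.Nullary.Decidable using (decidable-stable)

open Equivalence using (to; from)

not⇒¬ : ∀ {b} → T (not b) → ¬ T b
not⇒¬ nb t = subst T (to T-not-≡ nb) t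

box⇒ : ∀ μ {x y} → InBox μ x y → 1 ≤ x × 1 ≤ y × y ≤ row μ x
box⇒ μ {x} {y} box with to (T-∧ {1 ≤ᵇ x}) box
... | 1≤x , rest with to (T-∧ {1 ≤ᵇ y}) rest
... | 1≤y , y≤row = ≤ᵇ⇒≤ 1 x 1≤x , ≤ᵇ⇒≤ 1 y 1≤y , ≤ᵇ⇒≤ y (row μ x) y≤row

⇒box : ∀ μ {x y} → 1 ≤ x → 1 ≤ y → y ≤ row μ x → InBox μ x y
⇒box μ 1≤x 1≤y y≤row = from T-∧ (≤⇒≤ᵇ 1≤x , from T-∧ (≤⇒≤ᵇ 1≤y , ≤⇒≤ᵇ y≤row))

removable⇒ : ∀ μ {x y} → T (removableᵇ μ x y) →
  InBox μ x y × ¬ InBox μ (suc x) y × ¬ InBox μ x (suc y)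
removable⇒ μ {x} {y} t with to (T-∧ {inλᵇ μ x y}) t
... | box , rest with to (T-∧ {not (inλᵇ μ (suc x) y)}) rest
... | not-below , not-right = box , not⇒¬ not-below , not⇒¬ not-right

addable⇒ : ∀ μ {x y} → T (addableᵇ μ x y) →
  ¬ InBox μ x y × 1 ≤ x × 1 ≤ y ×
  (x ≡ 1 ⊎ InBox μ (x ∸ 1) y) × (y ≡ 1 ⊎ InBox μ x (y ∸ 1))
addable⇒ μ {x} {y} t with to (T-∧ {not (inλᵇ μ x y)}) t
... | not-box , r₁ with to (T-∧ {1 ≤ᵇ x}) r₁
... | 1≤x , r₂ with to (T-∧ {1 ≤ᵇ y}) r₂
... | 1≤y , r₃ with to (T-∧ {(x ≡ᵇ 1) ∨ inλᵇ μ (x ∸ 1) y}) r₃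
... | above , left =
  not⇒¬ not-box , ≤ᵇ⇒≤ 1 x 1≤x , ≤ᵇ⇒≤ 1 y 1≤y , first-or (to T-∨ above) , first-or (to T-∨ left)
  where
  first-or : ∀ {n} {P : Set} → T (n ≡ᵇ 1) ⊎ P → n ≡ 1 ⊎ P
  first-or {n} (inj₁ n≡1) = inj₁ (≡ᵇ⇒≡ n 1 n≡1)
  first-or (inj₂ p)       = inj₂ p

-- Rows and columns of a partition.  Only the decreasing order of the parts
-- matters, so the lemmas assume  Linked _≥_ μ.

col-accept : ∀ {a c} μ → c ≤ a → col (a ∷ μ) c ≡ suc (col μ c)
col-accept {a} {c} μ c≤a = cong length (filter-accept (c ≤?_) {a} {μ} c≤a)

col-reject : ∀ {a c} μ → ¬ c ≤ a → col (a ∷ μ) c ≡ col μ c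
col-reject {a} {c} μ c≰a = cong length (filter-reject (c ≤?_) {a} {μ} c≰a)

row-suc-≤ : ∀ {μ} → Linked _≥_ μ → ∀ {r} → 1 ≤ r → row μ (suc r) ≤ row μ r
row-suc-≤ {[]}        _          {suc r}       _ = z≤n
row-suc-≤ {a ∷ []}    _          {suc zero}    _ = z≤n
row-suc-≤ {a ∷ b ∷ μ} (b≤a ∷ _)  {suc zero}    _ = b≤a
row-suc-≤ {a ∷ μ}     decreasing {suc (suc r)} _ = row-suc-≤ (tail decreasing) (s≤s z≤n)

row-antitone : ∀ {μ} → Linked _≥_ μ → ∀ {r s} → 1 ≤ r → r ≤ s → row μ s ≤ row μ r
row-antitone decreasing {r} {s} 1≤r r≤s with m≤n⇒m<n∨m≡n r≤s
... | inj₂ refl = ≤-refl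
row-antitone decreasing {r} {suc s} 1≤r _ | inj₁ (s≤s r≤s) =
  ≤-trans (row-suc-≤ decreasing (≤-trans 1≤r r≤s)) (row-antitone decreasing 1≤r r≤s)

≤row⇒≤col : ∀ {μ} → Linked _≥_ μ → ∀ {r c} → 1 ≤ r → 1 ≤ c → c ≤ row μ r → r ≤ col μ c
≤row⇒≤col {[]}    _          {suc r} _ 1≤c c≤0 = ⊥-elim (<⇒≱ 1≤c c≤0)
≤row⇒≤col {a ∷ μ} _          {suc zero} {c} _ _ c≤a = ≤-trans (s≤s z≤n) (≤-reflexive (sym (col-accept μ c≤a)))
≤row⇒≤col {a ∷ μ} decreasing {suc (suc r)} {c} _ 1≤c c≤row = begin
  suc (suc r)      ≤⟨ s≤s (≤row⇒≤col (tail decreasing) (s≤s z≤n) 1≤c c≤row) ⟩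
  suc (col μ c)    ≡⟨ col-accept μ c≤a ⟨
  col (a ∷ μ) c    ∎
  where
  open ≤-Reasoning
  c≤a : c ≤ a
  c≤a = ≤-trans c≤row (row-antitone decreasing {1} {suc (suc r)} (s≤s z≤n) (s≤s z≤n))

≤col⇒≤row : ∀ {μ} → Linked _≥_ μ → ∀ {r c} → 1 ≤ r → 1 ≤ c → r ≤ col μ c → c ≤ row μ r
≤col⇒≤row {[]}    _          {suc r} _ _ ()
≤col⇒≤row {a ∷ μ} decreasing {r} {c} 1≤r 1≤c r≤col with c ≤? a
... | no c≰a = ⊥-elim (c≰a (≤-trans (≤col⇒≤row (tail decreasing) (s≤s z≤n) 1≤c 1≤col) (row-suc-≤ decreasing {1} (s≤s z≤n))))
  where
  1≤col : 1 ≤ col μ c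
  1≤col = ≤-trans 1≤r (subst (r ≤_) (col-reject μ c≰a) r≤col)
... | yes c≤a = on-row r 1≤r (subst (r ≤_) (col-accept μ c≤a) r≤col)
  where
  on-row : ∀ r → 1 ≤ r → r ≤ suc (col μ c) → c ≤ row (a ∷ μ) r
  on-row (suc zero)    _ _           = c≤a
  on-row (suc (suc r)) _ (s≤s r≤col) = ≤col⇒≤row (tail decreasing) (s≤s z≤n) 1≤c r≤col

hook-value : ∀ μ {a b m n} → row μ a ≡ b + m → col μ b ≡ a + n → hook μ a b ≡ m + n + 1
hook-value μ {a} {b} row-a col-b =
  cong₂ (λ arm leg → arm + leg + 1)
        (trans (cong (_∸ b) row-a) (m+n∸m≡n b _))
        (trans (cong (_∸ a) col-b) (m+n∸m≡n a _))

hook-positive : ∀ μ a b → 0 < hook μ a b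
hook-positive μ a b = m≤n+m 1 _

module _ {μ : List ℕ} (decreasing : Linked _≥_ μ) where

  column-box : ∀ {r c} → 1 ≤ r → 1 ≤ c → r ≤ col μ c → InBox μ r c
  column-box 1≤r 1≤c r≤col = ⇒box μ 1≤r 1≤c (≤col⇒≤row decreasing 1≤r 1≤c r≤col)

  col-suc-≤ : ∀ {c} → 1 ≤ c → col μ (suc c) ≤ col μ c
  col-suc-≤ {c} 1≤c with col μ (suc c) in col≡
  ... | zero  = z≤n
  ... | suc r = ≤row⇒≤col decreasing (s≤s z≤n) 1≤c
                  (≤-trans (n≤1+n c) (≤col⇒≤row decreasing (s≤s z≤n) (s≤s z≤n) (≤-reflexive (sym col≡))))

  hook-down : ∀ {r c} → 1 ≤ r → suc r ≤ col μ c → hook μ (suc r) c < hook μ r c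
  hook-down {r} {c} 1≤r r<col =
    +-monoˡ-< 1 (+-mono-≤-< (∸-monoˡ-≤ c (row-suc-≤ decreasing 1≤r)) (∸-monoʳ-< (n<1+n r) r<col))

  hook-right : ∀ {r c} → 1 ≤ c → suc c ≤ row μ r → hook μ r (suc c) < hook μ r c
  hook-right {r} {c} 1≤c c<row =
    +-monoˡ-< 1 (+-mono-<-≤ (∸-monoʳ-< (n<1+n c) c<row) (∸-monoˡ-≤ r (col-suc-≤ 1≤c)))

  removable-shape : ∀ {x y} → T (removableᵇ μ x y) →
    1 ≤ x × 1 ≤ y × row μ x ≡ y × col μ y ≡ x
  removable-shape {x} {y} t with removable⇒ μ {x} {y} t
  ... | box , not-below , not-right with box⇒ μ {x} {y} box
  ... | 1≤x , 1≤y , y≤row = 1≤x , 1≤y , ≤-antisym row≤y y≤row , ≤-antisym col≤x (≤row⇒≤col decreasing 1≤x 1≤y y≤row)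
    where
    row≤y : row μ x ≤ y
    row≤y = ≮⇒≥ (λ y<row → not-right (⇒box μ 1≤x (s≤s z≤n) y<row))
    col≤x : col μ y ≤ x
    col≤x = ≮⇒≥ (λ x<col → not-below (column-box (s≤s z≤n) 1≤y x<col))

  addable-shape : ∀ {x y} → T (addableᵇ μ x y) →
    1 ≤ x × 1 ≤ y × suc (row μ x) ≡ y × suc (col μ y) ≡ x
  addable-shape {x} {y} t with addable⇒ μ {x} {y} t
  ... | not-box , 1≤x , 1≤y , above , left =
    1≤x , 1≤y , ≤-antisym row<y (just-past 1≤y row-bound) , ≤-antisym col<x (just-past 1≤x col-bound)
    where
    just-past : ∀ {m n} → 1 ≤ m → m ∸ 1 ≤ n → m ≤ suc n
    just-past (s≤s z≤n) = s≤s
    row<y : row μ x < y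
    row<y = ≰⇒> (λ y≤row → not-box (⇒box μ 1≤x 1≤y y≤row))
    col<x : col μ y < x
    col<x = ≰⇒> (λ x≤col → not-box (column-box 1≤x 1≤y x≤col))
    row-bound : y ∸ 1 ≤ row μ x
    row-bound = [ (λ y≡1 → subst (λ n → n ∸ 1 ≤ row μ x) (sym y≡1) z≤n)
                , (λ box → proj₂ (proj₂ (box⇒ μ {x} box))) ]′ left
    col-bound : x ∸ 1 ≤ col μ y
    col-bound = [ (λ x≡1 → subst (λ n → n ∸ 1 ≤ col μ y) (sym x≡1) z≤n)
                , (λ box → let (1≤x-1 , _ , y≤row) = box⇒ μ {x ∸ 1} {y} box
                           in ≤row⇒≤col decreasing 1≤x-1 1≤y y≤row) ]′ above

-- The JM condition, read as a propagation rule for divisibility of hooks.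
module _ {ℓ : ℕ} {μ : List ℕ} (jm : IsJM ℓ μ) where

  jm-column : ∀ {a b x y} → InBox μ a b → ℓ ∣ hook μ a b →
    InBox μ a y → ¬ ℓ ∣ hook μ a y → InBox μ x b → ℓ ∣ hook μ x b
  jm-column {a} {b} {x} {y} ab ℓ∣ab ay ℓ∤ay xb =
    decidable-stable (ℓ ∣? hook μ x b) (λ ℓ∤xb → jm (a , b , x , y , ab , ay , xb , ℓ∣ab , ℓ∤ay , ℓ∤xb))

  jm-row : ∀ {a b x y} → InBox μ a b → ℓ ∣ hook μ a b →
    InBox μ x b → ¬ ℓ ∣ hook μ x b → InBox μ a y → ℓ ∣ hook μ a y
  jm-row {a} {b} {x} {y} ab ℓ∣ab xb ℓ∤xb ay =
    decidable-stable (ℓ ∣? hook μ a y) (λ ℓ∤ay → jm (a , b , x , y , ab , ay , xb , ℓ∣ab , ℓ∤ay , ℓ∤xb))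

multiple-gap : ∀ {ℓ m n} → ℓ ∣ m → ℓ ∣ n → n < m → n + ℓ ≤ m
multiple-gap {ℓ} {m} {n} ℓ∣m ℓ∣n n<m = begin
  n + ℓ        ≤⟨ +-monoʳ-≤ n (∣⇒≤ {{>-nonZero (m<n⇒0<n∸m n<m)}} ℓ∣m∸n) ⟩
  n + (m ∸ n)  ≡⟨ m+[n∸m]≡n (<⇒≤ n<m) ⟩
  m            ∎
  where
  open ≤-Reasoning
  ℓ∣m∸n : ℓ ∣ m ∸ n
  ℓ∣m∸n = ∣m+n∣m⇒∣n (subst (ℓ ∣_) (sym (m+[n∸m]≡n (<⇒≤ n<m))) ℓ∣m) ℓ∣n

descending-multiples : ∀ {ℓ} (f : ℕ → ℕ) k → (∀ j → j < k → f (suc j) < f j) →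
  (∀ j → j ≤ k → ℓ ∣ f j) → 0 < f k → suc k * ℓ ≤ f 0
descending-multiples {ℓ} f zero _ ℓ∣f 0<f0 =
  ≤-trans (≤-reflexive (+-identityʳ ℓ)) (∣⇒≤ {{>-nonZero 0<f0}} (ℓ∣f 0 z≤n))
descending-multiples {ℓ} f (suc k) descending ℓ∣f 0<fk = begin
  suc (suc k) * ℓ  ≡⟨ +-comm ℓ (suc k * ℓ) ⟩
  suc k * ℓ + ℓ    ≤⟨ +-monoˡ-≤ ℓ tail-bound ⟩
  f 1 + ℓ          ≤⟨ multiple-gap (ℓ∣f 0 z≤n) (ℓ∣f 1 (s≤s z≤n)) (descending 0 (s≤s z≤n)) ⟩
  f 0              ∎
  where
  open ≤-Reasoning
  tail-bound : suc k * ℓ ≤ f 1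
  tail-bound = descending-multiples (λ j → f (suc j)) k
    (λ j j<k → descending (suc j) (s≤s j<k)) (λ j j≤k → ℓ∣f (suc j) (s≤s j≤k)) 0<fk

excess-bound : ∀ p k {m} → suc k * suc p ≤ m + k + 1 → suc k * p ≤ m
excess-bound p k {m} bound = +-cancelʳ-≤ (suc k) _ _ (subst₂ _≤_ (expand p k) (regroup m k) bound)
  where
  expand : ∀ p k → suc k * suc p ≡ suc k * p + suc k
  expand = solve-∀
  regroup : ∀ m k → m + k + 1 ≡ m + suc k
  regroup = solve-∀

module _ {μ : List ℕ} (decreasing : Linked _≥_ μ) {p : ℕ} where

  column-bound : ∀ {a b m k} → 1 ≤ a → row μ a ≡ b + m → col μ b ≡ a + k →
    (∀ j → j ≤ k → suc p ∣ hook μ (j + a) b) → suc k * p ≤ m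
  column-bound {a} {b} {m} {k} 1≤a row-a col-b divisible = excess-bound p k
    (subst (suc k * suc p ≤_) (hook-value μ row-a col-b)
      (descending-multiples (λ j → hook μ (j + a) b) k step divisible (hook-positive μ (k + a) b)))
    where
    step : ∀ j → j < k → hook μ (suc j + a) b < hook μ (j + a) b
    step j j<k = hook-down decreasing (≤-trans 1≤a (m≤n+m a j))
      (subst (suc j + a ≤_) (trans (+-comm k a) (sym col-b)) (+-monoˡ-≤ a j<k))

  row-bound : ∀ {a b m k} → 1 ≤ b → row μ a ≡ b + k → col μ b ≡ a + m →
    (∀ j → j ≤ k → suc p ∣ hook μ a (j + b)) → suc k * p ≤ m
  row-bound {a} {b} {m} {k} 1≤b row-a col-b divisible = excess-bound p k
    (subst (suc k * suc p ≤_) (trans (hook-value μ row-a col-b) (cong (_+ 1) (+-comm k m)))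
      (descending-multiples (λ j → hook μ a (j + b)) k step divisible (hook-positive μ a (k + b))))
    where
    step : ∀ j → j < k → hook μ a (suc j + b) < hook μ a (j + b)
    step j j<k = hook-right decreasing {a} (≤-trans 1≤b (m≤n+m b j))
      (subst (suc j + b ≤_) (trans (+-comm k b) (sym row-a)) (+-monoˡ-≤ b j<k))

residue-suc : ∀ p x y → residue (suc p) x y ≡ (y + p * x) % suc p
residue-suc p x y = cong (_% suc p) (trans (cong (_∸ x) (regroup y x p)) (m+n∸n≡m (y + p * x) x))
  where
  regroup : ∀ y x p → y + suc p * x ≡ y + p * x + x
  regroup = solve-∀

same-residue⇒ : ∀ {p x y x′ y′} → residue (suc p) x y ≡ residue (suc p) x′ y′ →
  (y + p * x) % suc p ≡ (y′ + p * x′) % suc p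
same-residue⇒ {p} {x} {y} {x′} {y′} same =
  trans (sym (residue-suc p x y)) (trans same (residue-suc p x′ y′))

congruent-difference : ∀ {ℓ} .{{_ : NonZero ℓ}} a b n c →
  a % ℓ ≡ b % ℓ → a + n ≡ b + c * ℓ → ℓ ∣ n
congruent-difference {ℓ} a b n c a≡b eq =
  ∣m+n∣m⇒∣n (divides (b / ℓ + c) (+-cancelˡ-≡ (a % ℓ) _ _ shifted)) (n∣m*n (a / ℓ))
  where
  open ≡-Reasoning
  shifted : a % ℓ + (a / ℓ * ℓ + n) ≡ a % ℓ + (b / ℓ + c) * ℓ
  shifted = begin
    a % ℓ + (a / ℓ * ℓ + n)      ≡⟨ +-assoc (a % ℓ) _ n ⟨
    a % ℓ + a / ℓ * ℓ + n        ≡⟨ cong (_+ n) (m≡m%n+[m/n]*n a ℓ) ⟨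
    a + n                        ≡⟨ eq ⟩
    b + c * ℓ                    ≡⟨ cong (_+ c * ℓ) (m≡m%n+[m/n]*n b ℓ) ⟩
    b % ℓ + b / ℓ * ℓ + c * ℓ    ≡⟨ cong (λ r → r + b / ℓ * ℓ + c * ℓ) a≡b ⟨
    a % ℓ + b / ℓ * ℓ + c * ℓ    ≡⟨ +-assoc (a % ℓ) _ _ ⟩
    a % ℓ + (b / ℓ * ℓ + c * ℓ)  ≡⟨ cong (a % ℓ +_) (*-distribʳ-+ ℓ (b / ℓ) c) ⟨
    a % ℓ + (b / ℓ + c) * ℓ      ∎

indivisible-one : ∀ {p} → 1 ≤ p → ¬ suc p ∣ 1
indivisible-one 1≤p ℓ∣1 = <⇒≢ (s≤s 1≤p) (sym (∣1⇒≡1 ℓ∣1))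

below-identity : ∀ y p x k d → y + p * suc (x + k) + (d + k + 1) ≡ y + d + p * x + suc k * suc p
below-identity = solve-∀

above-identity : ∀ y p x h k → y + p * suc (x + h) + (k + suc h + 1) ≡ suc (y + k) + p * x + suc h * suc p
above-identity = solve-∀

same-row-identity : ∀ y p x → y + p * x + 1 ≡ suc y + p * x + 0 * suc p
same-row-identity = solve-∀

_≺_ : ℕ × ℕ × Sign → ℕ × ℕ × Sign → Set
(L , x , _) ≺ (L′ , x′ , _) = L < L′ ⊎ (L ≡ L′ × x < x′)

-- An addable position k + 1 rows below and d columns left of a box, with
-- d ≥ p (k + 1), lies on a strictly smaller ladder (this is where ℓ > 2 is used).
ladder-below : ∀ {p x k y d} → 2 ≤ p → 1 ≤ y → suc k * p ≤ d →
  ladder (suc p) (suc (x + k)) y < ladder (suc p) x (y + d)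
ladder-below {p} {x} {k} {suc y₀} {d} 2≤p _ bound = begin-strict
  suc (x + k) + p * y₀    ≡⟨ regroup x k (p * y₀) ⟩
  x + (suc k + p * y₀)    <⟨ +-monoʳ-< x (+-monoˡ-< (p * y₀) k<d) ⟩
  x + (d + p * y₀)        ≤⟨ +-monoʳ-≤ x (+-monoˡ-≤ (p * y₀) (m≤n*m d p {{p-nonzero}})) ⟩
  x + (p * d + p * y₀)    ≡⟨ cong (x +_) (trans (+-comm (p * d) (p * y₀)) (sym (*-distribˡ-+ p y₀ d))) ⟩
  x + p * (y₀ + d)        ∎
  where
  open ≤-Reasoning
  regroup : ∀ x k a → suc (x + k) + a ≡ x + (suc k + a)
  regroup = solve-∀
  p-nonzero : NonZero p
  p-nonzero = >-nonZero (≤-trans (s≤s z≤n) 2≤p)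
  k<d : suc k < d
  k<d = <-≤-trans (m<m*n (suc k) 2 (s≤s (s≤s z≤n))) (≤-trans (*-monoʳ-≤ (suc k) 2≤p) bound)

ladder-above-≤ : ∀ {p x h y₀ k} → suc k * p ≤ suc h →
  x + p * (suc y₀ + k) ≤ suc (x + h) + p * y₀
ladder-above-≤ {p} {x} {h} {y₀} {k} bound = begin
  x + p * (suc y₀ + k)     ≡⟨ expand x p y₀ k ⟩
  x + (suc k * p + p * y₀) ≤⟨ +-monoʳ-≤ x (+-monoˡ-≤ (p * y₀) bound) ⟩
  x + (suc h + p * y₀)     ≡⟨ regroup x h (p * y₀) ⟩
  suc (x + h) + p * y₀     ∎
  where
  open ≤-Reasoning
  expand : ∀ x p y₀ k → x + p * (suc y₀ + k) ≡ x + (suc k * p + p * y₀)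
  expand = solve-∀
  regroup : ∀ x h a → x + (suc h + a) ≡ suc (x + h) + a
  regroup = solve-∀

ladder-above : ∀ {p x h y k} → 1 ≤ y → suc k * p ≤ suc h →
  (ladder (suc p) x (suc (y + k)) , x , plus) ≺ (ladder (suc p) (suc (x + h)) y , suc (x + h) , minus)
ladder-above {p} {x} {h} {suc y₀} {k} _ bound with m≤n⇒m<n∨m≡n (ladder-above-≤ {p} {x} {h} {y₀} {k} bound)
... | inj₁ lower-ladder = inj₁ lower-ladder
... | inj₂ same-ladder  = inj₂ (same-ladder , s≤s (m≤m+n x h))

module _ {p : ℕ} (2≤p : 2 ≤ p) {μ : List ℕ} (decreasing : Linked _≥_ μ) (jm : IsJM (suc p) μ) where

  1≤p : 1 ≤ p
  1≤p = ≤-trans (s≤s z≤n) 2≤p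

  corner-indivisible : ∀ {x y} → row μ x ≡ y → col μ y ≡ x → ¬ suc p ∣ hook μ x y
  corner-indivisible {x} {y} row-x col-y ℓ∣hook = indivisible-one 1≤p
    (subst (suc p ∣_) (hook-value μ {x} {y} {0} {0} (trans row-x (sym (+-identityʳ _))) (trans col-y (sym (+-identityʳ _)))) ℓ∣hook)

  -- Addable position in a lower row: column y′ below row x is saturated by
  -- multiples of p + 1, so y′ lies far to the left of y.
  addable-below : ∀ {x y x′ y′} → 1 ≤ x → 1 ≤ y → row μ x ≡ y → col μ y ≡ x →
    1 ≤ y′ → suc (col μ y′) ≡ x′ → x < x′ →
    (y + p * x) % suc p ≡ (y′ + p * x′) % suc p →
    ladder (suc p) x′ y′ < ladder (suc p) x y
  addable-below {x} {y} {x′} {y′} 1≤x 1≤y row-x col-y 1≤y′ col-y′ x<x′ congruent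
    with m≤n⇒∃[o]m+o≡n x<x′
  ... | k , refl
    with m≤n⇒∃[o]m+o≡n (subst (y′ ≤_) row-x (≤col⇒≤row decreasing 1≤x 1≤y′
           (subst (x ≤_) (sym (suc-injective col-y′)) (m≤m+n x k))))
  ... | d , refl = ladder-below {p} {x} {k} {y′} {d} 2≤p 1≤y′ (column-bound decreasing 1≤x row-x col-y′′ column-divisible)
    where
    col-y′′ : col μ y′ ≡ x + k
    col-y′′ = suc-injective col-y′
    ℓ∣hook : suc p ∣ hook μ x y′
    ℓ∣hook = subst (suc p ∣_) (sym (hook-value μ row-x col-y′′))
      (congruent-difference (y′ + p * suc (x + k)) (y′ + d + p * x) _ (suc k)
        (sym congruent) (below-identity y′ p x k d))
    column-divisible : ∀ j → j ≤ k → suc p ∣ hook μ (j + x) y′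
    column-divisible j j≤k = jm-column jm {x} {y′} {j + x} {y′ + d}
      (column-box decreasing 1≤x 1≤y′ (subst (x ≤_) (sym col-y′′) (m≤m+n x k))) ℓ∣hook
      (⇒box μ 1≤x 1≤y (≤-reflexive (sym row-x))) (corner-indivisible row-x col-y)
      (column-box decreasing (≤-trans 1≤x (m≤n+m x j)) 1≤y′
        (subst (j + x ≤_) (trans (+-comm k x) (sym col-y′′)) (+-monoˡ-≤ x j≤k)))

  same-row-absurd : ∀ {x y y′} → y′ ≡ suc y → (y + p * x) % suc p ≡ (y′ + p * x) % suc p → ⊥
  same-row-absurd {x} {y} refl congruent =
    indivisible-one 1≤p (congruent-difference (y + p * x) (suc y + p * x) 1 0 congruent (same-row-identity y p x))

  -- Addable position in a higher row: the transposed argument, along row x′.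
  addable-above : ∀ {x y x′ y′} → 1 ≤ y → row μ x ≡ y → col μ y ≡ x →
    1 ≤ x′ → suc (row μ x′) ≡ y′ → x′ < x →
    (y + p * x) % suc p ≡ (y′ + p * x′) % suc p →
    (ladder (suc p) x′ y′ , x′ , plus) ≺ (ladder (suc p) x y , x , minus)
  addable-above {x} {y} {x′} {y′} 1≤y row-x col-y 1≤x′ row-x′ x′<x congruent
    with m≤n⇒∃[o]m+o≡n x′<x
  ... | h , refl
    with m≤n⇒∃[o]m+o≡n (≤col⇒≤row decreasing 1≤x′ 1≤y
           (subst (x′ ≤_) (sym col-y) (≤-trans (m≤m+n x′ h) (n≤1+n _))))
  ... | k , y+k≡row with trans (cong suc y+k≡row) row-x′
  ... | refl = ladder-above {p} {x′} {h} {y} {k} 1≤y (row-bound decreasing 1≤y row-x′′ col-y′′ row-divisible)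
    where
    row-x′′ : row μ x′ ≡ y + k
    row-x′′ = sym y+k≡row
    col-y′′ : col μ y ≡ x′ + suc h
    col-y′′ = trans col-y (sym (+-suc x′ h))
    ℓ∣hook : suc p ∣ hook μ x′ y
    ℓ∣hook = subst (suc p ∣_) (sym (hook-value μ row-x′′ col-y′′))
      (congruent-difference (y + p * suc (x′ + h)) (suc (y + k) + p * x′) _ (suc h)
        congruent (above-identity y p x′ h k))
    row-divisible : ∀ j → j ≤ k → suc p ∣ hook μ x′ (j + y)
    row-divisible j j≤k = jm-row jm {x′} {y} {suc (x′ + h)} {j + y}
      (⇒box μ 1≤x′ 1≤y (subst (y ≤_) (sym row-x′′) (m≤m+n y k))) ℓ∣hook
      (⇒box μ (s≤s z≤n) 1≤y (≤-reflexive (sym row-x))) (corner-indivisible row-x col-y)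
      (⇒box μ 1≤x′ (≤-trans 1≤y (m≤n+m y j))
        (subst (j + y ≤_) (trans (+-comm k y) (sym row-x′′)) (+-monoˡ-≤ y j≤k)))

  plus-precedes-minus : ∀ {x y x′ y′} → T (removableᵇ μ x y) → T (addableᵇ μ x′ y′) →
    residue (suc p) x y ≡ residue (suc p) x′ y′ →
    (ladder (suc p) x′ y′ , x′ , plus) ≺ (ladder (suc p) x y , x , minus)
  plus-precedes-minus {x} {y} {x′} {y′} removable addable same-residue
    with removable-shape decreasing removable | addable-shape decreasing addable | <-cmp x x′
  ... | 1≤x , 1≤y , row-x , col-y | _ , 1≤y′ , _ , col-y′ | tri< x<x′ _ _ =
    inj₁ (addable-below {x} {y} {x′} {y′} 1≤x 1≤y row-x col-y 1≤y′ col-y′ x<x′ (same-residue⇒ {p} {x} {y} {x′} {y′} same-residue))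
  ... | _ , _ , row-x , _ | _ , _ , row-x′ , _ | tri≈ _ refl _ =
    ⊥-elim (same-row-absurd {x} {y} {y′} (trans (sym row-x′) (cong suc row-x)) (same-residue⇒ {p} {x} {y} {x′} {y′} same-residue))
  ... | _ , 1≤y , row-x , col-y | 1≤x′ , _ , row-x′ , _ | tri> _ _ x′<x =
    addable-above {x} {y} {x′} {y′} 1≤y row-x col-y 1≤x′ row-x′ x′<x (same-residue⇒ {p} {x} {y} {x′} {y′} same-residue)

SignedPos : Set
SignedPos = ℕ × ℕ × Sign

sign : SignedPos → Sign
sign e = proj₂ (proj₂ e)

data Entry (ℓ : ℕ) .{{_ : NonZero ℓ}} (μ : List ℕ) (i : ℕ) : SignedPos → Set where
  removable : ∀ {x y} → T (removableᵇ μ x y) → residue ℓ x y ≡ i →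
              Entry ℓ μ i (ladder ℓ x y , x , minus)
  addable   : ∀ {x y} → T (addableᵇ μ x y) → residue ℓ x y ≡ i →
              Entry ℓ μ i (ladder ℓ x y , x , plus)

signed-entries : ∀ ℓ .{{_ : NonZero ℓ}} μ i → All (Entry ℓ μ i) (signed ℓ μ i)
signed-entries ℓ μ i = concat⁺ (map⁺ (universal (λ (x , y) → entries-at x y) (candidates μ)))
  where
  entries-at : ∀ x y → All (Entry ℓ μ i)
    (if residue ℓ x y ≡ᵇ i
     then (if removableᵇ μ x y then (ladder ℓ x y , x , minus) ∷ []
           else if addableᵇ μ x y then (ladder ℓ x y , x , plus) ∷ []
           else [])
     else [])
  entries-at x y with residue ℓ x y ≡ᵇ i in res | removableᵇ μ x y in rem | addableᵇ μ x y in add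
  ... | false | _     | _     = []
  ... | true  | true  | _     = removable (from T-≡ rem) (≡ᵇ⇒≡ _ _ (from T-≡ res)) ∷ []
  ... | true  | false | true  = addable (from T-≡ add) (≡ᵇ⇒≡ _ _ (from T-≡ res)) ∷ []
  ... | true  | false | false = []

Sorted : List SignedPos → Set
Sorted = Linked (λ e d → T (beforeᵇ e d))

before-total : ∀ e d → ¬ T (beforeᵇ e d) → T (beforeᵇ d e)
before-total (L , x , _) (L′ , x′ , _) not-before with <-cmp L L′
... | tri< L<L′ _ _ = ⊥-elim (not-before (from T-∨ (inj₁ (<⇒<ᵇ L<L′))))
... | tri> _ _ L′<L = from T-∨ (inj₁ (<⇒<ᵇ L′<L))
... | tri≈ _ refl _ = from T-∨ (inj₂ (from T-∧ (≡⇒≡ᵇ L L refl , ≤⇒≤ᵇ (≰⇒≥ x≰x′))))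
  where
  x≰x′ : ¬ x ≤ x′
  x≰x′ x≤x′ = not-before (from T-∨ (inj₂ (from T-∧ (≡⇒≡ᵇ L L refl , ≤⇒≤ᵇ x≤x′))))

≺⇒¬before : ∀ e d → e ≺ d → ¬ T (beforeᵇ d e)
≺⇒¬before (L , x , _) (L′ , x′ , _) (inj₁ L<L′) before with to (T-∨ {L′ <ᵇ L}) before
... | inj₁ L′<L = <-asym L<L′ (<ᵇ⇒< L′ L L′<L)
... | inj₂ same = <-irrefl (sym (≡ᵇ⇒≡ L′ L (proj₁ (to (T-∧ {L′ ≡ᵇ L}) same)))) L<L′
≺⇒¬before (L , x , _) (.L , x′ , _) (inj₂ (refl , x<x′)) before with to (T-∨ {L <ᵇ L}) before
... | inj₁ L<L = <-irrefl refl (<ᵇ⇒< L L L<L)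
... | inj₂ same = <⇒≱ x<x′ (≤ᵇ⇒≤ x′ x (proj₂ (to (T-∧ {L ≡ᵇ L}) same)))

insert-after : ∀ d e S → T (beforeᵇ d e) → Sorted (d ∷ S) → Sorted (d ∷ insert e S)
insert-after d e [] d≤e _ = d≤e ∷ [-]
insert-after d e (d₂ ∷ S) d≤e (d≤d₂ ∷ sorted) with beforeᵇ e d₂ in e≤d₂
... | true  = d≤e ∷ from T-≡ e≤d₂ ∷ sorted
... | false = d≤d₂ ∷ insert-after d₂ e S (before-total e d₂ (subst T e≤d₂)) sorted

insert-sorted : ∀ e S → Sorted S → Sorted (insert e S)
insert-sorted e [] _ = [-]
insert-sorted e (d ∷ S) sorted with beforeᵇ e d in e≤d
... | true  = from T-≡ e≤d ∷ sorted
... | false = insert-after d e S (before-total e d (subst T e≤d)) sorted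

sort-sorted : ∀ es → Sorted (sort es)
sort-sorted []       = []
sort-sorted (e ∷ es) = insert-sorted e (sort es) (sort-sorted es)

insert-all : ∀ {P : SignedPos → Set} {e} S → P e → All P S → All P (insert e S)
insert-all [] pe _ = pe ∷ []
insert-all {e = e} (d ∷ S) pe (pd ∷ pS) with beforeᵇ e d
... | true  = pe ∷ pd ∷ pS
... | false = pd ∷ insert-all S pe pS

sort-all : ∀ {P : SignedPos → Set} es → All P es → All P (sort es)
sort-all []       _          = []
sort-all (e ∷ es) (pe ∷ pes) = insert-all (sort es) pe (sort-all es pes)

sorted-no-minus-plus : ∀ {P : SignedPos → Set} →
  (∀ {m q} → P m → P q → sign m ≡ minus → sign q ≡ plus → q ≺ m) →
  ∀ S → Sorted S → All P S → ¬ HasMinusPlus (map sign S)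
sorted-no-minus-plus precedes (m ∷ q ∷ S) (m≤q ∷ _) (pm ∷ pq ∷ _) ([] , v , eq) =
  ≺⇒¬before q m (precedes pm pq (∷-injectiveˡ eq) (∷-injectiveˡ (∷-injectiveʳ eq))) m≤q
sorted-no-minus-plus precedes (_ ∷ S) sorted (_ ∷ pS) (_ ∷ u , v , eq) =
  sorted-no-minus-plus precedes S (tail sorted) pS (u , v , ∷-injectiveʳ eq)
sorted-no-minus-plus _ []       _ _ ([]    , _ , ())
sorted-no-minus-plus _ []       _ _ (_ ∷ _ , _ , ())
sorted-no-minus-plus _ (_ ∷ []) _ _ ([]    , _ , ())

lemma4p6 : (ℓ : ℕ) .{{_ : NonZero ℓ}} → 2 < ℓ →
    (λ′ : List ℕ) → IsPartition λ′ → IsJM ℓ λ′ →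
    (i : ℕ) → i < ℓ →
    ¬ HasMinusPlus (ladderSignature ℓ λ′ i)
lemma4p6 (suc p) (s≤s 2≤p) μ (_ , decreasing) jm i _ =
  sorted-no-minus-plus minus-after-plus (sort entries) (sort-sorted entries)
    (sort-all entries (signed-entries (suc p) μ i))
  where
  entries : List SignedPos
  entries = signed (suc p) μ i
  minus-after-plus : ∀ {m q} → Entry (suc p) μ i m → Entry (suc p) μ i q →
    sign m ≡ minus → sign q ≡ plus → q ≺ m
  minus-after-plus (removable {x} {y} rem res) (addable {x′} {y′} add res′) refl refl =
    plus-precedes-minus 2≤p decreasing jm {x} {y} {x′} {y′} rem add (trans res (sym res′))
  minus-after-plus (addable _ _)   _               () _
  minus-after-plus (removable _ _) (removable _ _) _  ()
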